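{- Let $H$ be an instance as described in the context. Run the following algorithm: initially $M$ matches every agent $a$ to $p^*_a$. Then consider the programs one by one in an arbitrary order; when program $p$ is considered, go through the agents on $p$'s preference list from least preferred to most preferred by $p$, and for each such agent $a$, if there exists $a'\in M(p)$ with $a>_p a'$ and $p>_a M(a)$, then reassign $a$ from $M(a)$ to $p$. Output $M$. Then the output matching $M$ is stable.
   Context: An instance consists of a bipartite graph $(\mathcal{A}\cup\mathcal{B},E)$, agents $\mathcal{A}$, programs $\mathcal{B}$, $(a,p)\in E$ iff mutually acceptable; every agent has a non-empty preference list. Each agent and each program ranks its neighbours in a strict order ($y>_x z$: $x$ prefers $y$ to $z$). Each program $p$ has a non-negative integer cost $c(p)$; programs have no quotas. A matching $M\subseteq E$ assigns each agent to at most one program (a program may receive any number of agents); $M(a)$, $M(p)$ denote partners. A pair $(a,p)\in E\setminus M$ blocks $M$ if $p>_a M(a)$ and there is $a'\in M(p)$ with $a>_p a'$; $M$ is stable if no pair blocks it. For an agent $a$, $p^*_a$ is the program of minimum cost on $a$'s preference list, ties broken in favour of the program $a$ prefers most. -}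

module Defs where

open import Data.Nat using (ℕ; _<_; _<ᵇ_)
open import Data.Nat.Properties using (_<?_)
open import Data.Bool using (Bool; true; false; if_then_else_)
open import Data.Fin using (Fin)
open import Data.Fin.Properties using (_≟_)
open import Data.List using (List; []; _∷_; foldl; reverse; allFin)
open import Data.List.Membership.Propositional using (_∈_)
open import Data.List.Relation.Unary.Any using (Any; any?)
open import Data.List.Relation.Unary.Unique.Propositional using (Unique)
open import Data.Product using (Σ; _×_; _,_; ∃)
open import Data.Empty using (⊥-elim)
open import Relation.Nullary using (¬_; Dec; does; yes; no)
open import Relation.Nullary.Decidable using (_×-dec_)
open import Relation.Binary.PropositionalEquality using (_≡_; _≢_; refl)
open import Function.Bundles using (_⇔_)
import Data.List.Membership.DecPropositional as DecMem

-- Preference lists: a strict order over the acceptable partners is a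
-- duplicate-free list, most preferred first.

-- position of the (first) occurrence of y in l (length l if absent)
pos : ∀ {n} → List (Fin n) → Fin n → ℕ
pos [] y = 0
pos (x ∷ xs) y with x ≟ y
... | yes _ = 0
... | no  _ = Data.Nat.suc (pos xs y)

Prefers : ∀ {n} → List (Fin n) → Fin n → Fin n → Set
Prefers l y z = (y ∈ l) × (z ∈ l) × (pos l y < pos l z)

prefers? : ∀ {n} (l : List (Fin n)) (y z : Fin n) → Dec (Prefers l y z)
prefers? l y z = (y ∈? l) ×-dec ((z ∈? l) ×-dec (pos l y <? pos l z))
  where open DecMem _≟_

record Instance : Set where
  field
    nA nP     : ℕ
    agentPref : Fin nA → List (Fin nP)
    progPref  : Fin nP → List (Fin nA)
    agentStrict : ∀ a → Unique (agentPref a)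
    progStrict  : ∀ p → Unique (progPref p)
    -- (a,p) ∈ E iff mutually acceptable
    mutualAcc : ∀ a p → (p ∈ agentPref a) ⇔ (a ∈ progPref p)
    nonEmpty  : ∀ a → agentPref a ≢ []
    cost      : Fin nP → ℕ

module _ (H : Instance) where
  open Instance H

  -- a matching in which every agent is matched: M a is a's program
  Matching : Set
  Matching = Fin nA → Fin nP

  IsMatching : Matching → Set
  IsMatching M = ∀ a → M a ∈ agentPref a

  Blocks : Matching → Fin nA → Fin nP → Set
  Blocks M a p = (p ∈ agentPref a) × (M a ≢ p)
               × Prefers (agentPref a) p (M a)
               × ∃ λ a' → (M a' ≡ p) × Prefers (progPref p) a a'

  Stable : Matching → Set
  Stable M = ∀ a p → ¬ Blocks M a p

  -- minimum-cost program of a list; ties broken towards the earliest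
  -- (i.e. most preferred) one
  minCost : List (Fin nP) → Fin nP → Fin nP
  minCost l x = foldl (λ b q → if cost q <ᵇ cost b then q else b) x l

  pstarL : (l : List (Fin nP)) → l ≢ [] → Fin nP
  pstarL [] ne = ⊥-elim (ne refl)
  pstarL (x ∷ xs) _ = minCost xs x

  pstar : Fin nA → Fin nP
  pstar a = pstarL (agentPref a) (nonEmpty a)

  M₀ : Matching
  M₀ = pstar

  update : Matching → Fin nA → Fin nP → Matching
  update M a p b with b ≟ a
  ... | yes _ = p
  ... | no  _ = M b

  beatsSomeone? : (M : Matching) (p : Fin nP) (a : Fin nA) →
                  Dec (Any (λ a' → (M a' ≡ p) × Prefers (progPref p) a a') (allFin nA))
  beatsSomeone? M p a = any? (λ a' → (M a' ≟ p) ×-dec prefers? (progPref p) a a') (allFin nA)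

  stepAgent : Fin nP → Matching → Fin nA → Matching
  stepAgent p M a with does (beatsSomeone? M p a ×-dec prefers? (agentPref a) p (M a))
  ... | true  = update M a p
  ... | false = M

  processProgram : Matching → Fin nP → Matching
  processProgram M p = foldl (stepAgent p) M (reverse (progPref p))

  algorithm : List (Fin nP) → Matching
  algorithm order = foldl processProgram M₀ order

-- Every reassignment moves an agent to a program it strictly prefers, and a
-- program gains agents only while it is being processed. Suppose a' ∈ M(p) at
-- the end and a >_p a'. Then a' was held by p already during p's processing,
-- and since p considers its agents from worst to best, a' was held when a was
-- considered: so a either moved to p or already held a program it liked at
-- least as much. As agents only improve afterwards, p >_a M(a) is impossible.

module Submission where

open import Defs
open import Data.Fin using (Fin)
open import Data.List using (List; allFin; []; _∷_; _++_; foldl; foldr)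
open import Data.List.Relation.Binary.Permutation.Propositional using (_↭_; ↭-sym)
open import Data.Product using (_×_; _,_; ∃₂; map₁)
open import Data.Nat using (ℕ; _≤_; _<_; _<ᵇ_; s≤s)
open import Data.Nat.Properties using (≤-refl; ≤-reflexive; ≤-trans; <-trans; <⇒≤; <-≤-trans; <-irrefl; ≮⇒≥)
open import Data.Bool using (true; false)
open import Data.Fin.Properties using (_≟_)
open import Data.List.Properties using (foldl-++; foldr-++; reverse-foldl)
open import Data.List.Membership.Propositional using (_∈_; _∉_; lose)
open import Data.List.Membership.Propositional.Properties using (∈-allFin)
open import Data.List.Relation.Binary.Permutation.Propositional.Properties using (∈-resp-↭)
open import Data.List.Relation.Unary.Any using (Any; here; there; any?)
open import Data.Sum using (_⊎_; inj₁; inj₂; map₂)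
open import Data.Empty using (⊥-elim)
open import Relation.Nullary using (¬_; yes; no; does; proof; ofʸ; ofⁿ)
open import Relation.Nullary.Decidable using (_×-dec_)
open import Relation.Binary.PropositionalEquality using (_≡_; _≢_; refl; sym; trans; cong; subst; module ≡-Reasoning)

∈-splitLast : ∀ {n} (x : Fin n) xs → x ∈ xs → ∃₂ λ us vs → xs ≡ us ++ x ∷ vs × x ∉ vs
∈-splitLast x (y ∷ xs) x∈ with any? (x ≟_) xs | x∈
... | yes x∈xs | _ with us , vs , refl , x∉vs ← ∈-splitLast x xs x∈xs = y ∷ us , vs , refl , x∉vs
... | no x∉xs | here refl   = [] , xs , refl , x∉xs
... | no x∉xs | there x∈xs = ⊥-elim (x∉xs x∈xs)

pos-<-split : ∀ {n} (l : List (Fin n)) y z → pos l y < pos l z →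
              ∃₂ λ us vs → l ≡ us ++ y ∷ vs × z ∉ y ∷ us
pos-<-split (x ∷ l) y z lt with x ≟ y | x ≟ z
... | yes refl | no x≢z = [] , l , refl , λ { (here refl) → x≢z refl }
... | no x≢y | no x≢z
  with s≤s lt′ ← lt
  with us , vs , refl , z∉ ← pos-<-split l y z lt′ =
  x ∷ us , vs , refl , λ { (here refl) → z∉ (here refl)
                         ; (there (here refl)) → x≢z refl
                         ; (there (there z∈us)) → z∉ (there z∈us) }

Prefers-trans : ∀ {n} {l : List (Fin n)} {x y z} → Prefers l x y → Prefers l y z → Prefers l x z
Prefers-trans (x∈ , _ , x<y) (_ , z∈ , y<z) = x∈ , z∈ , <-trans x<y y<z

module Algorithm (H : Instance) where
  open Instance H

  Rank : Fin nA → Fin nP → ℕ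
  Rank a = pos (agentPref a)

  StaysOrImproves : (Fin nP → Set) → Matching H → Matching H → Fin nA → Set
  StaysOrImproves P M M' x = M' x ≡ M x ⊎ (P (M' x) × Prefers (agentPref x) (M' x) (M x))

  record Reassigns (P : Fin nP → Set) (M M' : Matching H) : Set where
    constructor reassigns
    field moves : ∀ x → StaysOrImproves P M M' x

  Reassigns-refl : ∀ {P} M → Reassigns P M M
  Reassigns-refl M = reassigns λ _ → inj₁ refl

  Reassigns-trans : ∀ {P M M' M''} → Reassigns P M M' → Reassigns P M' M'' → Reassigns P M M''
  Reassigns-trans {P} {M} {M'} {M''} (reassigns r) (reassigns r') = reassigns moves
    where
    moves : ∀ x → StaysOrImproves P M M'' x
    moves x with r x | r' x
    ... | inj₁ e        | inj₁ e′         = inj₁ (trans e′ e)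
    ... | inj₁ e        | inj₂ (q , pr′)  rewrite e = inj₂ (q , pr′)
    ... | inj₂ moved    | inj₁ e′         rewrite e′ = inj₂ moved
    ... | inj₂ (_ , pr) | inj₂ (q , pr′)  = inj₂ (q , Prefers-trans pr′ pr)

  Reassigns-weaken : ∀ {P Q M M'} → (∀ {q} → P q → Q q) → Reassigns P M M' → Reassigns Q M M'
  Reassigns-weaken P⇒Q (reassigns r) = reassigns λ x → map₂ (map₁ P⇒Q) (r x)

  Reassigns-isMatching : ∀ {P M M'} → Reassigns P M M' → IsMatching H M → IsMatching H M'
  Reassigns-isMatching (reassigns r) m x with r x
  ... | inj₁ e                  rewrite e = m x
  ... | inj₂ (_ , (q∈ , _ , _)) = q∈

  Reassigns-rank : ∀ {P M M'} → Reassigns P M M' → ∀ x → Rank x (M' x) ≤ Rank x (M x)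
  Reassigns-rank (reassigns r) x with r x
  ... | inj₁ e                  rewrite e = ≤-refl
  ... | inj₂ (_ , (_ , _ , lt)) = <⇒≤ lt

  Reassigns-origin : ∀ {P M M' x q} → Reassigns P M M' → ¬ P q → M' x ≡ q → M x ≡ q
  Reassigns-origin {x = x} (reassigns r) ¬Pq e with r x
  ... | inj₁ e′       = trans (sym e′) e
  ... | inj₂ (Pq , _) rewrite e = ⊥-elim (¬Pq Pq)

  stepAgent-reassigns : ∀ p M b → Reassigns (_≡ p) M (stepAgent H p M b)
  stepAgent-reassigns p M b = reassigns moves
    where
    moves : ∀ x → StaysOrImproves (_≡ p) M (stepAgent H p M b) x
    moves x
      with does (beatsSomeone? H M p b ×-dec prefers? (agentPref b) p (M b))
         | proof (beatsSomeone? H M p b ×-dec prefers? (agentPref b) p (M b))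
    ... | false | _ = inj₁ refl
    ... | true | ofʸ (_ , pr) with x ≟ b
    ...   | yes refl = inj₂ (refl , pr)
    ...   | no _     = inj₁ refl

  stepAgent-others : ∀ p M b x → x ≢ b → stepAgent H p M b x ≡ M x
  stepAgent-others p M b x x≢b
    with does (beatsSomeone? H M p b ×-dec prefers? (agentPref b) p (M b))
  ... | false = refl
  ... | true with x ≟ b
  ...   | yes x≡b = ⊥-elim (x≢b x≡b)
  ...   | no _    = refl

  stepAgent-fires : ∀ p M b → Any (λ a' → (M a' ≡ p) × Prefers (progPref p) b a') (allFin nA) →
                    Prefers (agentPref b) p (M b) → stepAgent H p M b b ≡ p
  stepAgent-fires p M b beats pr
    with does (beatsSomeone? H M p b ×-dec prefers? (agentPref b) p (M b))
       | proof (beatsSomeone? H M p b ×-dec prefers? (agentPref b) p (M b))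
  ... | false | ofⁿ ¬fires = ⊥-elim (¬fires (beats , pr))
  ... | true  | _ with b ≟ b
  ...   | yes _   = refl
  ...   | no b≢b = ⊥-elim (b≢b refl)

  sweep : Fin nP → Matching H → List (Fin nA) → Matching H
  sweep p = foldr (λ a M → stepAgent H p M a)

  processProgram-sweep : ∀ M p → processProgram H M p ≡ sweep p M (progPref p)
  processProgram-sweep M p = reverse-foldl (stepAgent H p) M (progPref p)

  sweep-reassigns : ∀ p M T → Reassigns (_≡ p) M (sweep p M T)
  sweep-reassigns p M []      = Reassigns-refl M
  sweep-reassigns p M (b ∷ T) =
    Reassigns-trans (sweep-reassigns p M T) (stepAgent-reassigns p (sweep p M T) b)

  sweep-untouched : ∀ p M T x → x ∉ T → sweep p M T x ≡ M x
  sweep-untouched p M []      x _   = refl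
  sweep-untouched p M (b ∷ T) x x∉ =
    trans (stepAgent-others p (sweep p M T) b x (λ x≡b → x∉ (here x≡b)))
          (sweep-untouched p M T x (λ x∈ → x∉ (there x∈)))

  processProgram-reassigns : ∀ M p → Reassigns (_≡ p) M (processProgram H M p)
  processProgram-reassigns M p =
    subst (Reassigns (_≡ p) M) (sym (processProgram-sweep M p)) (sweep-reassigns p M (progPref p))

  processPrograms-reassigns : ∀ M ys → Reassigns (_∈ ys) M (foldl (processProgram H) M ys)
  processPrograms-reassigns M []       = Reassigns-refl M
  processPrograms-reassigns M (q ∷ ys) = Reassigns-trans
    (Reassigns-weaken (λ { refl → here refl }) (processProgram-reassigns M q))
    (Reassigns-weaken there (processPrograms-reassigns (processProgram H M q) ys))

  minCost-∈ : ∀ l x → minCost H l x ∈ x ∷ l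
  minCost-∈ []       x = here refl
  minCost-∈ (y ∷ ys) x with cost y <ᵇ cost x
  ... | true  = there (minCost-∈ ys y)
  ... | false with minCost-∈ ys x
  ...   | here e  = here e
  ...   | there m = there (there m)

  M₀-isMatching : IsMatching H (M₀ H)
  M₀-isMatching a = pstarL-∈ (agentPref a) (nonEmpty a)
    where
    pstarL-∈ : ∀ l ne → pstarL H l ne ∈ l
    pstarL-∈ []       ne = ⊥-elim (ne refl)
    pstarL-∈ (x ∷ xs) _  = minCost-∈ xs x

  algorithm-isMatching : ∀ order → IsMatching H (algorithm H order)
  algorithm-isMatching order = Reassigns-isMatching (processPrograms-reassigns (M₀ H) order) M₀-isMatching

  processProgram-settles : ∀ {N p a a'} → IsMatching H N → p ∈ agentPref a →
                           Prefers (progPref p) a a' → processProgram H N p a' ≡ p →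
                           Rank a (processProgram H N p a) ≤ Rank a p
  processProgram-settles {N} {p} {a} {a'} N-matching p∈ a>a'@(_ , _ , a<a') a'↦p
    with us , vs , L≡ , a'∉ ← pos-<-split (progPref p) a a' a<a' =
    ≤-trans N'-below-K' K'-settled
    where
    open ≡-Reasoning
    K K' : Matching H
    K  = sweep p N vs
    K' = stepAgent H p K a

    N'≡ : processProgram H N p ≡ sweep p K' us
    N'≡ = begin
      processProgram H N p     ≡⟨ processProgram-sweep N p ⟩
      sweep p N (progPref p)   ≡⟨ cong (sweep p N) L≡ ⟩
      sweep p N (us ++ a ∷ vs) ≡⟨ foldr-++ _ N us (a ∷ vs) ⟩
      sweep p K' us            ∎

    K-a'↦p : K a' ≡ p
    K-a'↦p = begin
      K a'                    ≡⟨ stepAgent-others p K a a' (λ a'≡a → a'∉ (here a'≡a)) ⟨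
      K' a'                   ≡⟨ sweep-untouched p K' us a' (λ a'∈ → a'∉ (there a'∈)) ⟨
      sweep p K' us a'        ≡⟨ cong (λ M → M a') N'≡ ⟨
      processProgram H N p a' ≡⟨ a'↦p ⟩
      p                       ∎

    N'-below-K' : Rank a (processProgram H N p a) ≤ Rank a (K' a)
    N'-below-K' = subst (λ M → Rank a (M a) ≤ Rank a (K' a)) (sym N'≡) (Reassigns-rank (sweep-reassigns p K' us) a)

    K'-settled : Rank a (K' a) ≤ Rank a p
    K'-settled with prefers? (agentPref a) p (K a)
    ... | yes p>Ka = ≤-reflexive (cong (Rank a) (stepAgent-fires p K a (lose (∈-allFin a') (K-a'↦p , a>a')) p>Ka))
    ... | no p≯Ka  = ≤-trans (Reassigns-rank (stepAgent-reassigns p K a) a)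
                             (≮⇒≥ λ p<Ka → p≯Ka (p∈ , Reassigns-isMatching (sweep-reassigns p N vs) N-matching a , p<Ka))

lemma4 : (H : Instance) (order : List (Fin (Instance.nP H))) →
    order ↭ allFin (Instance.nP H) →
    IsMatching H (algorithm H order) × Stable H (algorithm H order)
lemma4 H order perm = algorithm-isMatching order , stable
  where
  open Algorithm H

  stable : Stable H (algorithm H order)
  stable a p (p∈ , _ , (_ , _ , p<Fa) , a' , Fa'↦p , a>a')
    with xs , ys , refl , p∉ys ← ∈-splitLast p order (∈-resp-↭ (↭-sym perm) (∈-allFin p))
    rewrite foldl-++ (processProgram H) (M₀ H) xs (p ∷ ys) =
    <-irrefl refl (<-≤-trans p<Fa (≤-trans (Reassigns-rank after-p a) settled))
    where
    N : Matching H
    N = algorithm H xs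

    after-p : Reassigns (_∈ ys) (processProgram H N p) (foldl (processProgram H) (processProgram H N p) ys)
    after-p = processPrograms-reassigns (processProgram H N p) ys

    settled : Rank a (processProgram H N p a) ≤ Rank a p
    settled = processProgram-settles (algorithm-isMatching xs) p∈ a>a' (Reassigns-origin after-p p∉ys Fa'↦p)
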